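{- Let $\widehat{X}$ be a sandpile graph whose sink has no outgoing edges. If $\mathcal{S}(0)=\{\text{sink}\}$, then $G_0=\{0\}$. Otherwise, $G_0$ is equal to the sandpile group of $\mathcal{S}(0)$, viewed as a subgroup of $\mathcal{M}(\widehat{X})$ via the natural inclusion.
   Context: A sandpile graph $\widehat{X}$ is a finite weakly connected directed multigraph (loops and multiple edges allowed) with a distinguished vertex, the sink, reachable by a directed path from every vertex; the set $V$ of non-sink vertices is nonempty, and $X$ is the digraph obtained by deleting the sink (with edge set $E$). A configuration assigns a nonnegative integer number of grains to each non-sink vertex; it is stable if every $v$ holds fewer than $\deg^{+}(v)$ (out-degree) grains. Toppling an unstable vertex sends one grain along each of its out-edges (grains at the sink vanish; the sink never topples); every configuration has a unique stabilization. $\mathcal{M}(\widehat X)$ is the set of stable configurations with $a\oplus b$ = stabilization of $a+b$, a commutative monoid with identity $0$ (the empty configuration); the sandpile group is its minimal ideal (a group, consisting of the recurrent elements, i.e., those accessible from every element, where $a$ is accessible from $b$ if $b\oplus x=a$ for some $x$). For an idempotent $e$, $G_e$ is the unique maximal subgroup of $\mathcal M(\widehat X)$ with identity $e$. The support $\operatorname{supp}(m)$ is the set of vertices holding at least one grain. A cycle is a directed closed path of length $\ge1$ in $X$. For $W\subseteq V$, $\operatorname{cl}(W)$ is the set of $z\in V$ reachable by a directed path (possibly trivial) in $X$ from some $w\in W$. A set $W\subseteq V$ is strongly connected if each of its vertices reaches every other by a path in $X$; a strongly connected component is a maximal such set; it is cyclic if it contains a cycle. A vertex is acyclic if it lies on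 no cycle. For an idempotent $e$, $A(e)$ is the set of acyclic vertices $v\in V$ with $v\notin\operatorname{cl}(\operatorname{supp}(e))$ such that every cyclic strongly connected component reachable from $v$ by a path in $X$ intersects $\operatorname{supp}(e)$. $\mathcal{S}(e)$ is the subgraph of $\widehat X$ induced on $\operatorname{cl}(\operatorname{supp}(e))\cup A(e)\cup\{\text{sink}\}$ (with sink the same sink), whose edges are those of $\widehat X$ with tail in this vertex set. Sandpile configurations on such a subgraph are identified with configurations of $\widehat X$ that vanish outside its non-sink vertices (the natural inclusion), making its sandpile monoid and group subsets of $\mathcal M(\widehat X)$. -}

module Defs where

open import Data.Nat using (ℕ; zero; suc; _+_; _∸_; _<_; _≤_)
open import Data.Fin using (Fin; zero; suc; _≟_)
open import Data.Fin.Subset using (Subset; _∈_; _⊆_)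
open import Data.Product using (Σ; ∃; _×_; _,_)
open import Data.Sum using (_⊎_)
open import Data.Unit using (⊤)
open import Data.Bool using (if_then_else_)
open import Relation.Nullary using (¬_; does)
open import Relation.Binary.PropositionalEquality using (_≡_)
open import Relation.Binary.Construct.Closure.ReflexiveTransitive using (Star)

-- A finite directed multigraph (loops / multiple edges allowed) is given
-- by its edge multiplicities: adj u w = number of edges from u to w.

data Vtx (n : ℕ) : Set where
  sink : Vtx n
  nv   : Fin n → Vtx n

Adj : ℕ → Set
Adj n = Vtx n → Vtx n → ℕ

sumF : ∀ {n} → (Fin n → ℕ) → ℕ
sumF {zero}  f = 0
sumF {suc n} f = f zero + sumF (λ i → f (suc i))

outdeg : ∀ {n} → Adj n → Fin n → ℕ
outdeg adj u = adj (nv u) sink + sumF (λ w → adj (nv u) (nv w))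

data ReachHat {n} (adj : Adj n) : Vtx n → Vtx n → Set where
  here : ∀ {u} → ReachHat adj u u
  step : ∀ {u w v} → 0 < adj u w → ReachHat adj w v → ReachHat adj u v

-- a sandpile graph: finite, V nonempty, sink reachable from every vertex
-- (weak connectivity follows from the latter)
record SandpileGraph (n : ℕ) : Set where
  field
    adj           : Adj n
    nonempty      : 0 < n
    sinkReachable : ∀ v → ReachHat adj v sink

module _ {n : ℕ} (adj : Adj n) where

  Edge : Fin n → Fin n → Set
  Edge u w = 0 < adj (nv u) (nv w)

  data Path : Fin n → Fin n → Set where
    here : ∀ {u} → Path u u
    step : ∀ {u w v} → Edge u w → Path w v → Path u v

  data PathIn (C : Subset n) : Fin n → Fin n → Set where
    here : ∀ {u} → u ∈ C → PathIn C u u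
    step : ∀ {u w v} → u ∈ C → Edge u w → PathIn C w v → PathIn C u v

  OnCycle : Fin n → Set
  OnCycle v = ∃ λ w → Edge v w × Path w v

  Acyclic : Fin n → Set
  Acyclic v = ¬ OnCycle v

  cl : (Fin n → Set) → Fin n → Set
  cl W z = ∃ λ w → W w × Path w z

  StronglyConnected : Subset n → Set
  StronglyConnected W = ∀ x y → x ∈ W → y ∈ W → Path x y

  IsSCC : Subset n → Set
  IsSCC C = StronglyConnected C × (∀ W → StronglyConnected W → C ⊆ W → W ⊆ C)

  ContainsCycle : Subset n → Set
  ContainsCycle C = ∃ λ u → ∃ λ w → u ∈ C × Edge u w × PathIn C w u

  ReachableFrom : Fin n → Subset n → Set
  ReachableFrom v C = ∃ λ c → c ∈ C × Path v c

  Meets : Subset n → (Fin n → Set) → Set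
  Meets C W = ∃ λ x → x ∈ C × W x

-- Configurations and the sandpile monoid, relative to a set of non-sink
-- vertices `In` (In = everything gives X̂ itself; In = U gives the
-- subgraph on U ∪ {sink} with all edges of X̂ whose tail is in U,
-- configurations identified with those of X̂ vanishing outside U).

Cfg : ℕ → Set
Cfg n = Fin n → ℕ

supp : ∀ {n} → Cfg n → Fin n → Set
supp c v = 0 < c v

0̂ : ∀ {n} → Cfg n
0̂ _ = 0

_+̂_ : ∀ {n} → Cfg n → Cfg n → Cfg n
(a +̂ b) v = a v + b v

_≗̂_ : ∀ {n} → Cfg n → Cfg n → Set
a ≗̂ b = ∀ v → a v ≡ b v

module Monoid {n : ℕ} (adj : Adj n) (In : Fin n → Set) where

  Stable : Cfg n → Set
  Stable c = ∀ v → In v → c v < outdeg adj v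

  InM : Cfg n → Set
  InM c = (∀ v → ¬ In v → c v ≡ 0) × Stable c

  topple : Fin n → Cfg n → Cfg n
  topple u c w = (if does (u ≟ w) then c w ∸ outdeg adj u else c w)
                 + adj (nv u) (nv w)

  -- one toppling of an unstable vertex u ∈ In (grains sent to the sink vanish)
  Step : Cfg n → Cfg n → Set
  Step c c' = ∃ λ u → In u × outdeg adj u ≤ c u ×
              (∀ w → (In w → c' w ≡ topple u c w) × (¬ In w → c' w ≡ c w))

  Stabilizes : Cfg n → Cfg n → Set
  Stabilizes c s = Star Step c s × Stable s

  _⊕_≈_ : Cfg n → Cfg n → Cfg n → Set
  a ⊕ b ≈ c = ∃ λ s → Stabilizes (a +̂ b) s × (s ≗̂ c)

  Recurrent : Cfg n → Set
  Recurrent a = InM a × (∀ b → InM b → ∃ λ x → InM x × (b ⊕ x ≈ a))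

  IsSubgroupWithId : Cfg n → (Cfg n → Set) → Set
  IsSubgroupWithId e P =
      (∀ a → P a → InM a)
    × P e
    × (∀ a b s → P a → P b → Stabilizes (a +̂ b) s → P s)
    × (∀ a → P a → a ⊕ e ≈ a)
    × (∀ a → P a → ∃ λ b → P b × (a ⊕ b ≈ e))

  IsMaxSubgroup : Cfg n → (Cfg n → Set) → Set₁
  IsMaxSubgroup e P =
    IsSubgroupWithId e P × (∀ Q → IsSubgroupWithId e Q → ∀ a → Q a → P a)

module _ {n : ℕ} (adj : Adj n) where

  A : Cfg n → Fin n → Set
  A e v = Acyclic adj v × ¬ cl adj (supp e) v ×
          (∀ C → IsSCC adj C → ContainsCycle adj C → ReachableFrom adj v C →
             Meets adj C (supp e))

  VS : Cfg n → Fin n → Set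
  VS e v = cl adj (supp e) v ⊎ A e v

  module M̂ = Monoid adj (λ _ → ⊤)

  SandpileGroupS : Cfg n → Cfg n → Set
  SandpileGroupS e = Monoid.Recurrent adj (VS e)

module Submission where

-- Call a vertex cycle-free if it reaches no cycle of X; these are exactly the
-- non-sink vertices of S(0). A grain on a vertex that reaches a cycle never
-- disappears: toppling pushes a grain along the path to the cycle, where grains
-- circulate forever. So an element of G₀, which stabilises to 0 when added to
-- its inverse, is supported on cycle-free vertices. Conversely the stable
-- configurations supported there form a group with identity 0: on an acyclic
-- edge-closed set of vertices every stable configuration is reachable from any
-- start, by processing sources first, giving each just enough grains to be
-- congruent to its target modulo its out-degree and then toppling it.

open import Defs
open import Data.Fin using (Fin)
open import Data.Product using (∃; _×_)
open import Relation.Nullary using (¬_)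
open import Data.Unit using (⊤)
open import Relation.Binary.PropositionalEquality using (_≡_)

open import Data.Product using (∃₂; _,_; proj₁; proj₂)
open import Data.Nat using (ℕ; zero; suc; _+_; _*_; _∸_; _<_; _≤_; _<?_)
open import Data.Nat.Properties hiding (_≟_)
open import Data.Nat.Tactic.RingSolver using (solve-∀)
open import Algebra.Properties.CommutativeSemigroup +-commutativeSemigroup using (xy∙z≈xz∙y)
open import Data.Fin using (zero; suc; _≟_)
open import Data.Bool using (if_then_else_)
open import Data.Fin.Subset using (Subset) renaming (_∈_ to _∈ₛ_; _⊆_ to _⊆ₛ_)
open import Data.Fin.Induction using (spo-wellFounded; spo-noetherian)
open import Data.Vec using (tabulate)
open import Data.Vec.Properties using (lookup∘tabulate; lookup⇒[]=; []=⇒lookup)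
open import Data.List using (List; []; _∷_; length; filter; concatMap; allFin)
open import Data.List.Properties using (filter-notAll)
open import Data.List.Membership.Propositional using (_∈_; _∉_; find; lose)
open import Data.List.Membership.Propositional.Properties using (∈-concatMap⁺; ∈-concatMap⁻; ∈-allFin; ∈-filter⁺; ∈-filter⁻)
open import Data.List.Relation.Unary.Any using (here; there; any?)
open import Data.Sum using (inj₁; inj₂)
open import Data.Empty using (⊥-elim)
open import Data.Unit using (tt)
open import Function using (_∘_; flip)
open import Induction.WellFounded using (Acc; acc; WellFounded)
open import Relation.Nullary using (Dec; yes; no; does; ¬?)
open import Relation.Nullary.Decidable using (dec-true; ¬¬-excluded-middle)
open import Relation.Binary.Structures using (IsStrictPartialOrder)
open import Relation.Binary.PropositionalEquality using (_≢_; refl; sym; trans; cong; cong₂; subst; resp₂; isEquivalence; module ≡-Reasoning)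
open import Relation.Binary.Construct.Closure.ReflexiveTransitive using (Star; ε; _◅_; _◅◅_; gmap)

f≤sumF : ∀ {m} (f : Fin m → ℕ) i → f i ≤ sumF f
f≤sumF f zero    = m≤m+n _ _
f≤sumF f (suc i) = ≤-trans (f≤sumF (f ∘ suc) i) (m≤n+m _ _)

0≮⇒≡0 : ∀ {m} → ¬ 0 < m → m ≡ 0
0≮⇒≡0 0≮m = n≤0⇒n≡0 (≮⇒≥ 0≮m)

padToResidue : ∀ y {a d} → a < d → ∃₂ λ x q → x < d × y + x ≡ a + q * d
padToResidue zero    {a}         a<d = a , 0 , a<d , sym (+-identityʳ a)
padToResidue (suc y) {a} {suc d} a<d with padToResidue y a<d
... | suc x , q , x<d , eq = x , q , <-trans (n<1+n x) x<d , trans (sym (+-suc y x)) eq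
... | zero  , q , _   , eq = d , suc q , n<1+n d ,
      trans (cong (λ t → suc (t + d)) (trans (sym (+-identityʳ y)) eq)) (rearrange a (q * suc d) d)
  where
  rearrange : ∀ a qD d → suc (a + qD + d) ≡ a + suc (d + qD)
  rearrange = solve-∀

¬¬-decidable : ∀ {m p} (P : Fin m → Set p) → ¬ ¬ (∀ i → Dec (P i))
¬¬-decidable {zero}  P k = k (λ ())
¬¬-decidable {suc m} P k =
  ¬¬-decidable (P ∘ suc) λ dec → ¬¬-excluded-middle λ dec₀ → k λ { zero → dec₀ ; (suc i) → dec i }

module _ {m p} {P : Fin m → Set p} (P? : ∀ i → Dec (P i)) where

  subsetOf : Subset m
  subsetOf = tabulate (does ∘ P?)

  ∈-subsetOf⁺ : ∀ {i} → P i → i ∈ₛ subsetOf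
  ∈-subsetOf⁺ {i} Pi = lookup⇒[]= i subsetOf (trans (lookup∘tabulate _ i) (dec-true (P? i) Pi))

  ∈-subsetOf⁻ : ∀ {i} → i ∈ₛ subsetOf → P i
  ∈-subsetOf⁻ {i} i∈ with P? i | trans (sym (lookup∘tabulate _ i)) ([]=⇒lookup i∈)
  ... | yes Pi | _  = Pi
  ... | no _   | ()

module _ {n : ℕ} (adj : Adj n) (In : Fin n → Set) where
  open Monoid adj In

  IsMaxSubgroup-resp : ∀ {e P Q} → (∀ {a} → P a → Q a) → (∀ {a} → Q a → P a) →
                       IsMaxSubgroup e P → IsMaxSubgroup e Q
  IsMaxSubgroup-resp P⇒Q Q⇒P ((inM , e∈ , closed , identity , inverse) , maximal) =
    ( (λ a qa → inM a (Q⇒P qa))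
    , P⇒Q e∈
    , (λ a b s qa qb st → P⇒Q (closed a b s (Q⇒P qa) (Q⇒P qb) st))
    , (λ a qa → identity a (Q⇒P qa))
    , (λ a qa → let (b , pb , a⊕b) = inverse a (Q⇒P qa) in b , P⇒Q pb , a⊕b) )
    , λ R R-subgroup a ra → P⇒Q (maximal R R-subgroup a ra)

module Reachability {n : ℕ} (adj : Adj n) where

  Edge? : ∀ u w → Dec (Edge adj u w)
  Edge? u w = 0 <? adj (nv u) (nv w)

  _++ᵖ_ : ∀ {u v w} → Path adj u v → Path adj v w → Path adj u w
  here     ++ᵖ q = q
  step e p ++ᵖ q = step e (p ++ᵖ q)

  PathIn⇒Path : ∀ {C u v} → PathIn adj C u v → Path adj u v
  PathIn⇒Path (here _)     = here
  PathIn⇒Path (step _ e p) = step e (PathIn⇒Path p)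

  ReachesNoCycle : Fin n → Set
  ReachesNoCycle v = ∀ {z} → Path adj v z → ¬ OnCycle adj z

  reachesNoCycle-step : ∀ {u w} → ReachesNoCycle u → Edge adj u w → ReachesNoCycle w
  reachesNoCycle-step nc e p = nc (step e p)

  reachesNoCycle⇒noLoop : ∀ {u} → ReachesNoCycle u → adj (nv u) (nv u) ≡ 0
  reachesNoCycle⇒noLoop {u} nc = 0≮⇒≡0 λ e → nc here (u , e , here)

  reachesNoCycle⇒VS₀ : ∀ {v} → ReachesNoCycle v → VS adj 0̂ v
  reachesNoCycle⇒VS₀ {v} nc = inj₂ (nc here , (λ { (_ , () , _) }) , noCyclicSCCAhead)
    where
    noCyclicSCCAhead : ∀ C → IsSCC adj C → ContainsCycle adj C → ReachableFrom adj v C → Meets adj C (supp 0̂)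
    noCyclicSCCAhead C (sc , _) (u , w , u∈ , e , p) (c , c∈ , vc) =
      ⊥-elim (nc (vc ++ᵖ sc c u c∈ u∈) (w , e , PathIn⇒Path p))

  cyclicSCC : ∀ {z} → (∀ y → Dec (Path adj z y × Path adj y z)) → OnCycle adj z →
              ∃ λ C → IsSCC adj C × ContainsCycle adj C × z ∈ₛ C
  cyclicSCC {z} mutual? (w , e , wz) = C , (strong , maximal) , (z , w , z∈C , e , inside (step e here) wz) , z∈C
    where
    C : Subset n
    C = subsetOf mutual?

    z∈C : z ∈ₛ C
    z∈C = ∈-subsetOf⁺ mutual? (here , here)

    strong : StronglyConnected adj C
    strong x y x∈ y∈ = proj₂ (∈-subsetOf⁻ mutual? x∈) ++ᵖ proj₁ (∈-subsetOf⁻ mutual? y∈)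

    maximal : ∀ W → StronglyConnected adj W → C ⊆ₛ W → W ⊆ₛ C
    maximal W scW C⊆W {y} y∈W = ∈-subsetOf⁺ mutual? (scW z y (C⊆W z∈C) y∈W , scW y z y∈W (C⊆W z∈C))

    inside : ∀ {a} → Path adj z a → Path adj a z → PathIn adj C a z
    inside za here         = here (∈-subsetOf⁺ mutual? (za , here))
    inside za (step e' az) = step (∈-subsetOf⁺ mutual? (za , step e' az)) e' (inside (za ++ᵖ step e' here) az)

  -- The strongly connected component needed to refute membership in A(0) is only
  -- built under double negation, which suffices since the goal is a negation.
  VS₀⇒reachesNoCycle : ∀ {v} → VS adj 0̂ v → ReachesNoCycle v
  VS₀⇒reachesNoCycle (inj₁ (_ , () , _))
  VS₀⇒reachesNoCycle (inj₂ (_ , _ , meetsSupport)) {z} vz oc =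
    ¬¬-decidable (λ y → Path adj z y × Path adj y z) λ mutual? →
      let (C , scc , cyc , z∈C) = cyclicSCC mutual? oc
      in noGrain (meetsSupport C scc cyc (z , z∈C , vz))
    where
    noGrain : ∀ {C} → ¬ Meets adj C (supp 0̂)
    noGrain (_ , _ , ())

  _≺_ : Fin n → Fin n → Set
  u ≺ w = ReachesNoCycle u × ∃ λ v → Edge adj u v × Path adj v w

  ≺-isStrictPartialOrder : IsStrictPartialOrder _≡_ _≺_
  ≺-isStrictPartialOrder = record
    { isEquivalence = isEquivalence
    ; irrefl        = λ { refl (nc , v , e , p) → nc here (v , e , p) }
    ; trans         = λ { (nc , v , e , p) (_ , v' , e' , p') → nc , v , e , (p ++ᵖ step e' p') }
    ; <-resp-≈      = resp₂ _≺_
    }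

  ≺-wellFounded : WellFounded _≺_
  ≺-wellFounded = spo-wellFounded ≺-isStrictPartialOrder

  ≻-wellFounded : WellFounded (flip _≺_)
  ≻-wellFounded = spo-noetherian ≺-isStrictPartialOrder

  EdgeClosed : List (Fin n) → Set
  EdgeClosed L = ∀ {v w} → v ∈ L → Edge adj v w → w ∈ L

  record ClosedCover (S : Fin n → Set) : Set where
    field
      members   : List (Fin n)
      covers    : ∀ {v} → S v → v ∈ members
      closed    : EdgeClosed members
      cycleFree : ∀ {v} → v ∈ members → ReachesNoCycle v

  open ClosedCover

  ⋃-cover : ∀ {S : Fin n → Set} → (∀ v → Dec (S v)) → (∀ {v} → S v → ClosedCover (_≡ v)) → ClosedCover S
  ⋃-cover {S} S? cover = record
    { members   = concatMap part (allFin n)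
    ; covers    = λ {v} s → ∈-⋃ (part-covers (S? v) s)
    ; closed    = λ z∈ e → let (v , z∈v) = ∈-⋃⁻ z∈ in ∈-⋃ (part-closed (S? v) z∈v e)
    ; cycleFree = λ z∈ → let (v , z∈v) = ∈-⋃⁻ z∈ in part-cycleFree (S? v) z∈v
    }
    where
    partOf : ∀ v → Dec (S v) → List (Fin n)
    partOf v (yes s) = members (cover s)
    partOf v (no _)  = []

    part : Fin n → List (Fin n)
    part v = partOf v (S? v)

    ∈-⋃ : ∀ {v z} → z ∈ part v → z ∈ concatMap part (allFin n)
    ∈-⋃ {v} z∈ = ∈-concatMap⁺ part (lose (∈-allFin v) z∈)

    ∈-⋃⁻ : ∀ {z} → z ∈ concatMap part (allFin n) → ∃ λ v → z ∈ part v
    ∈-⋃⁻ z∈ = let (v , _ , z∈v) = find (∈-concatMap⁻ part {xs = allFin n} z∈) in v , z∈v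

    part-covers : ∀ {v} (s? : Dec (S v)) → S v → v ∈ partOf v s?
    part-covers (yes s) _ = covers (cover s) refl
    part-covers (no ¬s) s = ⊥-elim (¬s s)

    part-closed : ∀ {v} (s? : Dec (S v)) → EdgeClosed (partOf v s?)
    part-closed (yes s) = closed (cover s)

    part-cycleFree : ∀ {v z} (s? : Dec (S v)) → z ∈ partOf v s? → ReachesNoCycle z
    part-cycleFree (yes s) = cycleFree (cover s)

  coverVertex : ∀ {v} → ReachesNoCycle v → Acc (flip _≺_) v → ClosedCover (_≡ v)
  coverVertex {v} nc (acc rs) = record
    { members   = v ∷ members successors
    ; covers    = λ { refl → here refl }
    ; closed    = λ { (here refl) e → there (covers successors e) ; (there z∈) e → there (closed successors z∈ e) }
    ; cycleFree = λ { (here refl) → nc ; (there z∈) → cycleFree successors z∈ }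
    }
    where
    successors : ClosedCover (Edge adj v)
    successors = ⋃-cover (Edge? v) λ {w} e → coverVertex (reachesNoCycle-step nc e) (rs (nc , w , e , here))

  supportCover : ∀ {S : Fin n → Set} → (∀ v → Dec (S v)) → (∀ {v} → S v → ReachesNoCycle v) → ClosedCover S
  supportCover S? nc = ⋃-cover S? λ {v} s → coverVertex (nc s) (≻-wellFounded v)

  sourceIn : ∀ L → (∀ {v} → v ∈ L → ReachesNoCycle v) → ∀ {r} → r ∈ L → Acc _≺_ r →
             ∃ λ v → v ∈ L × (∀ {u} → u ∈ L → ¬ Edge adj u v)
  sourceIn L nc {r} r∈ (acc rs) with any? (λ u → Edge? u r) L
  ... | yes into-r = let (u , u∈ , e) = find into-r in sourceIn L nc u∈ (rs (nc u∈ , r , e , here))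
  ... | no ¬into-r = r , r∈ , λ u∈ e → ¬into-r (lose u∈ e)

  _-_ : List (Fin n) → Fin n → List (Fin n)
  L - v = filter (λ w → ¬? (w ≟ v)) L

  ∈-remove⁺ : ∀ {L v w} → w ∈ L → w ≢ v → w ∈ L - v
  ∈-remove⁺ = ∈-filter⁺ (λ w → ¬? (w ≟ _))

  ∈-remove⁻ : ∀ {L v w} → w ∈ L - v → w ∈ L × w ≢ v
  ∈-remove⁻ = ∈-filter⁻ (λ w → ¬? (w ≟ _))

  length-remove : ∀ {L v} → v ∈ L → length (L - v) < length L
  length-remove {L} v∈ = filter-notAll (λ w → ¬? (w ≟ _)) L (lose v∈ λ v≢v → v≢v refl)

  remove-source-closed : ∀ {L v} → EdgeClosed L → (∀ {u} → u ∈ L → ¬ Edge adj u v) → EdgeClosed (L - v)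
  remove-source-closed closed source u∈ e =
    let (u∈L , _) = ∈-remove⁻ u∈ in ∈-remove⁺ (closed u∈L e) λ { refl → source u∈L e }

module Dynamics {n : ℕ} (G : SandpileGraph n) where
  open SandpileGraph G
  open Reachability adj

  d : Fin n → ℕ
  d = outdeg adj

  0<outdeg : ∀ v → 0 < d v
  0<outdeg v with sinkReachable (nv v)
  ... | step {w = sink}  e _ = ≤-trans e (m≤m+n _ _)
  ... | step {w = nv w} e _ = ≤-trans (≤-trans e (f≤sumF (λ w → adj (nv v) (nv w)) w)) (m≤n+m _ _)

  CycleFreeSupport : Cfg n → Set
  CycleFreeSupport c = ∀ {v} → 0 < c v → ReachesNoCycle v

  +̂-cycleFreeSupport : ∀ {a b} → CycleFreeSupport a → CycleFreeSupport b → CycleFreeSupport (a +̂ b)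
  +̂-cycleFreeSupport {a} {b} cfa cfb {v} 0<a+b with 0 <? a v
  ... | yes 0<a = cfa 0<a
  ... | no 0≮a  = cfb (subst (0 <_) (cong (_+ b v) (0≮⇒≡0 0≮a)) 0<a+b)

  point : Fin n → ℕ → Cfg n
  point v m w = if does (v ≟ w) then m else 0

  point-self : ∀ v m → point v m v ≡ m
  point-self v m with v ≟ v
  ... | yes _  = refl
  ... | no v≢v = ⊥-elim (v≢v refl)

  point-other : ∀ {v w} m → v ≢ w → point v m w ≡ 0
  point-other {v} {w} m v≢w with v ≟ w
  ... | yes v≡w = ⊥-elim (v≢w v≡w)
  ... | no _    = refl

  module Toppling (In : Fin n → Set) (cycleFree⇒In : ∀ {u} → ReachesNoCycle u → In u) where
    open Monoid adj In
    open import Data.List.Membership.DecPropositional (_≟_ {n}) using (_∈?_)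

    topple-self : ∀ u c → topple u c u ≡ c u ∸ d u + adj (nv u) (nv u)
    topple-self u c with u ≟ u
    ... | yes _  = refl
    ... | no u≢u = ⊥-elim (u≢u refl)

    topple-other : ∀ {u w} c → u ≢ w → topple u c w ≡ c w + adj (nv u) (nv w)
    topple-other {u} {w} c u≢w with u ≟ w
    ... | yes u≡w = ⊥-elim (u≢w u≡w)
    ... | no _    = refl

    topple-unreached : ∀ {u w} c → u ≢ w → adj (nv u) (nv w) ≡ 0 → topple u c w ≡ c w
    topple-unreached {u} {w} c u≢w noEdge = begin
      topple u c w             ≡⟨ topple-other c u≢w ⟩
      c w + adj (nv u) (nv w)  ≡⟨ cong (c w +_) noEdge ⟩
      c w + 0                  ≡⟨ +-identityʳ (c w) ⟩
      c w                      ∎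
      where open ≡-Reasoning

    topple-cong : ∀ u {a a'} → a ≗̂ a' → topple u a ≗̂ topple u a'
    topple-cong u a≗a' w with u ≟ w
    ... | yes _ = cong (λ t → t ∸ d u + adj (nv u) (nv w)) (a≗a' w)
    ... | no _  = cong (_+ adj (nv u) (nv w)) (a≗a' w)

    topple-+̂ : ∀ {u a} z → d u ≤ a u → topple u (a +̂ z) ≗̂ (topple u a +̂ z)
    topple-+̂ {u} {a} z du≤au w with u ≟ w
    ... | yes refl = trans (cong (_+ adj (nv u) (nv u)) (+-∸-comm (z u) du≤au))
                           (xy∙z≈xz∙y (a u ∸ d u) (z u) (adj (nv u) (nv u)))
    ... | no _     = xy∙z≈xz∙y (a w) (z w) (adj (nv u) (nv w))

    Step-cong : ∀ {a a' b} → Step a b → a ≗̂ a' → Step a' b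
    Step-cong (u , u∈ , du≤au , after) a≗a' =
      u , u∈ , subst (d u ≤_) (a≗a' u) du≤au ,
      λ w → (λ w∈ → trans (proj₁ (after w) w∈) (topple-cong u a≗a' w)) ,
            (λ w∉ → trans (proj₂ (after w) w∉) (a≗a' w))

    Step-+̂ : ∀ {a b} z → Step a b → Step (a +̂ z) (b +̂ z)
    Step-+̂ z (u , u∈ , du≤au , after) =
      u , u∈ , ≤-trans du≤au (m≤m+n _ _) ,
      λ w → (λ w∈ → trans (cong (_+ z w) (proj₁ (after w) w∈)) (sym (topple-+̂ z du≤au w))) ,
            (λ w∉ → cong (_+ z w) (proj₂ (after w) w∉))

    toppleStep : ∀ {u c} → ReachesNoCycle u → d u ≤ c u → Step c (topple u c)
    toppleStep {u} {c} nc du≤cu = u , cycleFree⇒In nc , du≤cu , λ w → (λ _ → refl) , λ w∉ →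
      topple-unreached c (λ { refl → w∉ (cycleFree⇒In nc) })
                         (0≮⇒≡0 λ e → w∉ (cycleFree⇒In (reachesNoCycle-step nc e)))

    _↝_ : Cfg n → Cfg n → Set
    a ↝ b = ∃ λ s → Star Step a s × s ≗̂ b

    ≗̂⇒↝ : ∀ {a b} → a ≗̂ b → a ↝ b
    ≗̂⇒↝ {a} a≗b = a , ε , a≗b

    Star⇒↝ : ∀ {a b} → Star Step a b → a ↝ b
    Star⇒↝ {b = b} steps = b , steps , λ _ → refl

    Star-congˡ : ∀ {a a' s} → a ≗̂ a' → Star Step a s → a' ↝ s
    Star-congˡ {a' = a'} a≗a' ε           = a' , ε , λ w → sym (a≗a' w)
    Star-congˡ {s = s}   a≗a' (st ◅ sts) = s , Step-cong st a≗a' ◅ sts , λ _ → refl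

    ↝-trans : ∀ {a b c} → a ↝ b → b ↝ c → a ↝ c
    ↝-trans (s , steps , s≗b) (t , steps' , t≗c) =
      let (t' , steps'' , t'≗t) = Star-congˡ (λ w → sym (s≗b w)) steps'
      in t' , steps ◅◅ steps'' , λ w → trans (t'≗t w) (t≗c w)

    ↝-+̂ : ∀ {a b} z → a ↝ b → (a +̂ z) ↝ (b +̂ z)
    ↝-+̂ z (s , steps , s≗b) = s +̂ z , gmap (_+̂ z) (Step-+̂ z) steps , λ w → cong (_+ z w) (s≗b w)

    ↝⇒⊕ : ∀ a b {c} → (a +̂ b) ↝ c → Stable c → a ⊕ b ≈ c
    ↝⇒⊕ _ _ (s , steps , s≗c) stable = s , (steps , λ v v∈ → subst (_< d v) (sym (s≗c v)) (stable v v∈)) , s≗c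

    fire : Fin n → ℕ → Cfg n → Cfg n
    fire u zero    c = c
    fire u (suc k) c = topple u (fire u k c)

    fire-self : ∀ {u} → adj (nv u) (nv u) ≡ 0 → ∀ k c → fire u k c u ≡ c u ∸ k * d u
    fire-self     noLoop zero    c = refl
    fire-self {u} noLoop (suc k) c = begin
      topple u (fire u k c) u                      ≡⟨ topple-self u (fire u k c) ⟩
      fire u k c u ∸ d u + adj (nv u) (nv u)      ≡⟨ cong₂ (λ t l → t ∸ d u + l) (fire-self noLoop k c) noLoop ⟩
      c u ∸ k * d u ∸ d u + 0                     ≡⟨ +-identityʳ _ ⟩
      c u ∸ k * d u ∸ d u                         ≡⟨ ∸-+-assoc (c u) (k * d u) (d u) ⟩
      c u ∸ (k * d u + d u)                       ≡⟨ cong (c u ∸_) (+-comm (k * d u) (d u)) ⟩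
      c u ∸ suc k * d u                           ∎
      where open ≡-Reasoning

    fire-unreached : ∀ {u w} → u ≢ w → adj (nv u) (nv w) ≡ 0 → ∀ k c → fire u k c w ≡ c w
    fire-unreached u≢w noEdge zero    c = refl
    fire-unreached u≢w noEdge (suc k) c =
      trans (topple-unreached (fire _ k c) u≢w noEdge) (fire-unreached u≢w noEdge k c)

    fire-Star : ∀ {u} → ReachesNoCycle u → ∀ k c → k * d u ≤ c u → Star Step c (fire u k c)
    fire-Star nc zero    c _ = ε
    fire-Star {u} nc (suc k) c sk*d≤ =
      fire-Star nc k c (≤-trans (m≤n+m (k * d u) (d u)) sk*d≤) ◅◅ (toppleStep nc du≤ ◅ ε)
      where
      du≤ : d u ≤ fire u k c u
      du≤ = subst (d u ≤_) (sym (fire-self (reachesNoCycle⇒noLoop nc) k c))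
              (subst (_≤ c u ∸ k * d u) (m+n∸n≡m (d u) (k * d u)) (∸-monoˡ-≤ (k * d u) sk*d≤))

    fireToTarget : ∀ {v} → ReachesNoCycle v → ∀ y {t} → t < d v →
                   ∃₂ λ x y' → x < d v × Star Step (y +̂ point v x) y' × y' v ≡ t ×
                               (∀ {w} → v ≢ w → adj (nv v) (nv w) ≡ 0 → y' w ≡ y w)
    fireToTarget {v} nc y {t} t<d with padToResidue (y v) t<d
    ... | x , q , x<d , padded =
      x , fire v q c , x<d , fire-Star nc q c (subst (q * d v ≤_) (sym c-v) (m≤n+m _ _)) , fired-v , fired-w
      where
      c : Cfg n
      c = y +̂ point v x

      c-v : c v ≡ t + q * d v
      c-v = trans (cong (y v +_) (point-self v x)) padded

      fired-v : fire v q c v ≡ t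
      fired-v = trans (fire-self (reachesNoCycle⇒noLoop nc) q c)
                      (trans (cong (_∸ q * d v) c-v) (m+n∸n≡m t (q * d v)))

      fired-w : ∀ {w} → v ≢ w → adj (nv v) (nv w) ≡ 0 → fire v q c w ≡ y w
      fired-w {w} v≢w noEdge = trans (fire-unreached v≢w noEdge q c)
                                     (trans (cong (y w +_) (point-other x v≢w)) (+-identityʳ (y w)))

    record Settling (L : List (Fin n)) (y a : Cfg n) : Set where
      field
        extra      : Cfg n
        extra-out  : ∀ {w} → w ∉ L → extra w ≡ 0
        extra<d    : ∀ {w} → w ∈ L → extra w < d w
        result     : Cfg n
        topples    : (y +̂ extra) ↝ result
        result-in  : ∀ {w} → w ∈ L → result w ≡ a w
        result-out : ∀ {w} → w ∉ L → result w ≡ y w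

    extendSettling : ∀ {L v x y y' a} → v ∈ L → EdgeClosed L → x < d v →
                     Star Step (y +̂ point v x) y' → y' v ≡ a v →
                     (∀ {w} → v ≢ w → adj (nv v) (nv w) ≡ 0 → y' w ≡ y w) →
                     Settling (L - v) y' a → Settling L y a
    extendSettling {L} {v} {x} {y} {y'} {a} v∈ closed x<d fired y'v y'w S = record
      { extra      = point v x +̂ extra
      ; extra-out  = λ w∉ → cong₂ _+_ (point-other x (v≢ w∉)) (extra-out (w∉ ∘ proj₁ ∘ ∈-remove⁻))
      ; extra<d    = λ {w} w∈ → extended<d w∈ (v ≟ w)
      ; result     = result
      ; topples    = ↝-trans (≗̂⇒↝ λ w → sym (+-assoc (y w) (point v x w) (extra w)))
                             (↝-trans (↝-+̂ extra (Star⇒↝ fired)) topples)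
      ; result-in  = λ {w} w∈ → result-in' w∈ (v ≟ w)
      ; result-out = λ {w} w∉ → trans (result-out (w∉ ∘ proj₁ ∘ ∈-remove⁻))
                                      (y'w (v≢ w∉) (0≮⇒≡0 λ e → w∉ (closed v∈ e)))
      }
      where
      open Settling S

      v≢ : ∀ {w} → w ∉ L → v ≢ w
      v≢ w∉ refl = w∉ v∈

      v∉ : v ∉ L - v
      v∉ v∈' = proj₂ (∈-remove⁻ {L} v∈') refl

      extended<d : ∀ {w} → w ∈ L → Dec (v ≡ w) → point v x w + extra w < d w
      extended<d _  (yes refl) =
        subst (_< d v) (sym (trans (cong₂ _+_ (point-self v x) (extra-out v∉)) (+-identityʳ x))) x<d
      extended<d w∈ (no v≢w)   =
        subst (_< d _) (sym (cong (_+ extra _) (point-other x v≢w))) (extra<d (∈-remove⁺ w∈ (v≢w ∘ sym)))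

      result-in' : ∀ {w} → w ∈ L → Dec (v ≡ w) → result w ≡ a w
      result-in' _  (yes refl) = trans (result-out v∉) y'v
      result-in' w∈ (no v≢w)   = result-in (∈-remove⁺ w∈ (v≢w ∘ sym))

    -- Settle the vertices of L one source at a time: once a source is fixed,
    -- the later topplings inside the rest of L never send grains back to it.
    settle : ∀ k L → length L ≤ k → EdgeClosed L → (∀ {v} → v ∈ L → ReachesNoCycle v) →
             ∀ y a → (∀ {w} → w ∈ L → a w < d w) → Settling L y a
    settle _ [] _ _ _ y a _ = record
      { extra = 0̂ ; extra-out = λ _ → refl ; extra<d = λ ()
      ; result = y ; topples = ≗̂⇒↝ λ w → +-identityʳ (y w) ; result-in = λ () ; result-out = λ _ → refl }
    settle zero (_ ∷ _) () _ _ _ _ _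
    settle (suc k) L@(r ∷ _) len closed nc y a a<d
      with v , v∈ , source ← sourceIn L nc (here refl) (≺-wellFounded r)
      with x , y' , x<d , fired , y'v , y'w ← fireToTarget (nc v∈) y (a<d v∈)
      = extendSettling v∈ closed x<d fired y'v y'w
          (settle k (L - v) (≤-pred (≤-trans (length-remove v∈) len)) (remove-source-closed closed source)
                  (λ w∈ → nc (proj₁ (∈-remove⁻ w∈))) y' a (λ w∈ → a<d (proj₁ (∈-remove⁻ w∈))))

    accessible : ∀ c a → CycleFreeSupport (c +̂ a) → (∀ w → a w < d w) →
                 ∃ λ x → CycleFreeSupport x × (∀ w → x w < d w) × (c +̂ x) ↝ a
    accessible c a cf a<d = extra , extra-cycleFree , extra<d' , ↝-trans topples (≗̂⇒↝ result≗a)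
      where
      open ClosedCover (supportCover (λ v → 0 <? (c +̂ a) v) cf) renaming (members to L)
      open Settling (settle (length L) L ≤-refl closed cycleFree c a (λ {w} _ → a<d w))

      uncovered : ∀ {w} → w ∉ L → c w + a w ≡ 0
      uncovered w∉ = 0≮⇒≡0 λ 0<ca → w∉ (covers 0<ca)

      extra-cycleFree : CycleFreeSupport extra
      extra-cycleFree {w} 0<x with w ∈? L
      ... | yes w∈ = cycleFree w∈
      ... | no w∉  = ⊥-elim (<-irrefl (sym (extra-out w∉)) 0<x)

      extra<d' : ∀ w → extra w < d w
      extra<d' w with w ∈? L
      ... | yes w∈ = extra<d w∈
      ... | no w∉  = subst (_< d w) (sym (extra-out w∉)) (0<outdeg w)

      result≗a : result ≗̂ a
      result≗a w with w ∈? L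
      ... | yes w∈ = result-in w∈
      ... | no w∉  = trans (result-out w∉)
                           (trans (m+n≡0⇒m≡0 (c w) (uncovered w∉)) (sym (m+n≡0⇒n≡0 (c w) (uncovered w∉))))

  module X̂ = Monoid adj (λ _ → ⊤)
  module T̂ = Toppling (λ _ → ⊤) (λ _ → tt)

  topple-feeds : ∀ {u w} c → Edge adj u w → 0 < X̂.topple u c w
  topple-feeds {u} {w} c e with u ≟ w
  ... | yes _ = <-≤-trans e (m≤n+m _ _)
  ... | no _  = <-≤-trans e (m≤n+m _ _)

  GrainBeforeCycle : Cfg n → Set
  GrainBeforeCycle c = ∃₂ λ v z → 0 < c v × Path adj v z × OnCycle adj z

  grainBeforeCycle-Step : ∀ {c c'} → X̂.Step c c' → GrainBeforeCycle c → GrainBeforeCycle c'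
  grainBeforeCycle-Step {c} {c'} (u , _ , _ , after) (v , z , 0<cv , vz , oc) = moved (u ≟ v) 0<cv vz oc
    where
    feeds : ∀ {w} → Edge adj u w → 0 < c' w
    feeds {w} e = subst (0 <_) (sym (proj₁ (after w) tt)) (topple-feeds c e)

    keeps : ∀ {v} → u ≢ v → c v ≤ c' v
    keeps {v} u≢v = subst (c v ≤_) (sym (trans (proj₁ (after v) tt) (T̂.topple-other c u≢v))) (m≤m+n _ _)

    -- If v itself topples, the grain moves one step along the path towards the cycle.
    moved : ∀ {v z} → Dec (u ≡ v) → 0 < c v → Path adj v z → OnCycle adj z → GrainBeforeCycle c'
    moved {v} {z} (no u≢v) 0<cv vz oc       = v , z , <-≤-trans 0<cv (keeps u≢v) , vz , oc
    moved (yes refl) _ here oc@(w , e , wu) = w , u , feeds e , wu , oc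
    moved {z = z} (yes refl) _ (step e wz) oc = _ , z , feeds e , wz , oc

  grainBeforeCycle-Star : ∀ {c s} → Star X̂.Step c s → GrainBeforeCycle c → GrainBeforeCycle s
  grainBeforeCycle-Star ε           g = g
  grainBeforeCycle-Star (st ◅ sts) g = grainBeforeCycle-Star sts (grainBeforeCycle-Step st g)

  stabilizesTo0⇒cycleFree : ∀ {c s} → Star X̂.Step c s → s ≗̂ 0̂ → CycleFreeSupport c
  stabilizesTo0⇒cycleFree steps s≗0 0<cv vz oc =
    let (w , _ , 0<sw , _) = grainBeforeCycle-Star steps (_ , _ , 0<cv , vz , oc)
    in <-irrefl (sym (s≗0 w)) 0<sw

  cycleFreeSupport-Step : ∀ {c c'} → X̂.Step c c' → CycleFreeSupport c → CycleFreeSupport c'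
  cycleFreeSupport-Step {c} (u , _ , du≤cu , after) cf {w} 0<c'w with u ≟ w | 0 <? c w
  ... | yes refl | _         = cf (<-≤-trans (0<outdeg u) du≤cu)
  ... | no _     | yes 0<cw = cf 0<cw
  ... | no u≢w   | no 0≮cw  = reachesNoCycle-step (cf (<-≤-trans (0<outdeg u) du≤cu)) (subst (0 <_) c'w≡ 0<c'w)
    where
    c'w≡ : _ ≡ adj (nv u) (nv w)
    c'w≡ = trans (proj₁ (after w) tt)
                 (trans (T̂.topple-other c u≢w) (cong (_+ adj (nv u) (nv w)) (0≮⇒≡0 0≮cw)))

  cycleFreeSupport-Star : ∀ {c s} → Star X̂.Step c s → CycleFreeSupport c → CycleFreeSupport s
  cycleFreeSupport-Star ε           cf = cf
  cycleFreeSupport-Star (st ◅ sts) cf = cycleFreeSupport-Star sts (cycleFreeSupport-Step st cf)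

  CycleFreeStable : Cfg n → Set
  CycleFreeStable c = CycleFreeSupport c × (∀ v → c v < d v)

  G₀-isCycleFreeStable : X̂.IsMaxSubgroup 0̂ CycleFreeStable
  G₀-isCycleFreeStable =
    ( (λ _ (_ , stable) → (λ _ ¬⊤ → ⊥-elim (¬⊤ tt)) , λ v _ → stable v)
    , ((λ ()) , 0<outdeg)
    , (λ _ _ _ (cfa , _) (cfb , _) (steps , stable) →
         cycleFreeSupport-Star steps (+̂-cycleFreeSupport cfa cfb) , λ v → stable v tt)
    , (λ a (_ , stable) → T̂.↝⇒⊕ a 0̂ (T̂.≗̂⇒↝ λ v → +-identityʳ (a v)) λ v _ → stable v)
    , inverse )
    , maximal
    where
    inverse : ∀ a → CycleFreeStable a → ∃ λ b → CycleFreeStable b × (a X̂.⊕ b ≈ 0̂)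
    inverse a (cf , _) =
      let (x , cfx , x<d , a+x↝0) =
            T̂.accessible a 0̂ (λ {v} 0<a → cf (subst (0 <_) (+-identityʳ (a v)) 0<a)) 0<outdeg
      in x , (cfx , x<d) , T̂.↝⇒⊕ a x a+x↝0 λ v _ → 0<outdeg v

    maximal : ∀ Q → X̂.IsSubgroupWithId 0̂ Q → ∀ a → Q a → CycleFreeStable a
    maximal Q (inM , _ , _ , _ , inverseQ) a qa =
      let (b , _ , s , (steps , _) , s≗0) = inverseQ a qa
      in (λ 0<a → stabilizesTo0⇒cycleFree steps s≗0 (<-≤-trans 0<a (m≤m+n _ _))) ,
         λ v → proj₂ (inM a qa) v tt

  module S₀ = Monoid adj (VS adj 0̂)
  module T₀ = Toppling (VS adj 0̂) reachesNoCycle⇒VS₀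

  inS₀⇒cycleFreeStable : ∀ {c} → S₀.InM c → CycleFreeStable c
  inS₀⇒cycleFreeStable {c} (vanish , stable) = cf , stable'
    where
    cf : CycleFreeSupport c
    cf {v} 0<cv vz oc = <-irrefl (sym (vanish v λ v∈ → VS₀⇒reachesNoCycle v∈ vz oc)) 0<cv

    stable' : ∀ v → c v < d v
    stable' v with 0 <? c v
    ... | yes 0<cv = stable v (reachesNoCycle⇒VS₀ (cf 0<cv))
    ... | no 0≮cv  = subst (_< d v) (sym (0≮⇒≡0 0≮cv)) (0<outdeg v)

  cycleFreeStable⇒inS₀ : ∀ {c} → CycleFreeStable c → S₀.InM c
  cycleFreeStable⇒inS₀ (cf , stable) =
    (λ v v∉ → 0≮⇒≡0 λ 0<cv → v∉ (reachesNoCycle⇒VS₀ (cf 0<cv))) , λ v _ → stable v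

  cycleFreeStable⇒recurrent : ∀ {a} → CycleFreeStable a → S₀.Recurrent a
  cycleFreeStable⇒recurrent {a} (cf , stable) = cycleFreeStable⇒inS₀ (cf , stable) , λ b b∈ →
    let (cfb , _)                = inS₀⇒cycleFreeStable b∈
        (x , cfx , x<d , b+x↝a) = T₀.accessible b a (+̂-cycleFreeSupport cfb cf) stable
    in x , cycleFreeStable⇒inS₀ (cfx , x<d) , T₀.↝⇒⊕ b x b+x↝a λ v _ → stable v

  recurrent⇒cycleFreeStable : ∀ {a} → S₀.Recurrent a → CycleFreeStable a
  recurrent⇒cycleFreeStable = inS₀⇒cycleFreeStable ∘ proj₁

  noVertex⇒cycleFreeStable⇒0 : ¬ ∃ (VS adj 0̂) → ∀ {c} → CycleFreeStable c → ∀ v → c v ≡ 0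
  noVertex⇒cycleFreeStable⇒0 none (cf , _) v = 0≮⇒≡0 λ 0<cv → none (v , reachesNoCycle⇒VS₀ (cf 0<cv))

  0⇒cycleFreeStable : ∀ {c} → (∀ v → c v ≡ 0) → CycleFreeStable c
  0⇒cycleFreeStable c≡0 =
    (λ {v} 0<cv → ⊥-elim (<-irrefl (sym (c≡0 v)) 0<cv)) , λ v → subst (_< d v) (sym (c≡0 v)) (0<outdeg v)

-- Neither the sink's out-edges nor the nonemptiness of S(0) matter: the sink
-- never topples, and an empty S(0) has sandpile group {0}.
theorem3p5 : ∀ {n} (G : SandpileGraph n) →
    (∀ w → SandpileGraph.adj G sink w ≡ 0) →
    ((¬ ∃ λ (v : Fin n) → VS (SandpileGraph.adj G) 0̂ v) →
    Monoid.IsMaxSubgroup (SandpileGraph.adj G) (λ _ → ⊤) 0̂ (λ c → ∀ v → c v ≡ 0))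
    × ((∃ λ (v : Fin n) → VS (SandpileGraph.adj G) 0̂ v) →
    Monoid.IsMaxSubgroup (SandpileGraph.adj G) (λ _ → ⊤) 0̂ (SandpileGroupS (SandpileGraph.adj G) 0̂))
theorem3p5 G _ =
    (λ none → G₀-resp (noVertex⇒cycleFreeStable⇒0 none) 0⇒cycleFreeStable)
  , (λ _ → G₀-resp cycleFreeStable⇒recurrent recurrent⇒cycleFreeStable)
  where
  open SandpileGraph G
  open Dynamics G
  G₀-resp : ∀ {P} → (∀ {a} → CycleFreeStable a → P a) → (∀ {a} → P a → CycleFreeStable a) →
            X̂.IsMaxSubgroup 0̂ P
  G₀-resp to from = IsMaxSubgroup-resp adj (λ _ → ⊤) to from G₀-isCycleFreeStable
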